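{- Let $\mathcal T$ be a strong monad on a symmetric monoidal category $\mathcal C$ and $X$ an object. If $(Z,\iota)$ is a terminal central cone of $\mathcal T$ at $X$, then $\iota:Z\to\mathcal TX$ is a monomorphism.
   Context: For a strong monad $(\mathcal T,\eta,\mu,\tau)$ on a symmetric monoidal category $(\mathcal C,\otimes,I,\gamma)$ with right strength $\tau'_{X,Y}=\mathcal T(\gamma_{Y,X})\circ\tau_{Y,X}\circ\gamma_{\mathcal TX,Y}$, a central cone of $\mathcal T$ at $X$ is a pair $(Z,\iota)$ with $\iota:Z\to\mathcal TX$ such that for every object $Y$, $\mu_{X\otimes Y}\circ\mathcal T\tau'_{X,Y}\circ\tau_{\mathcal TX,Y}\circ(\iota\otimes\mathrm{id}_{\mathcal TY})=\mu_{X\otimes Y}\circ\mathcal T\tau_{X,Y}\circ\tau'_{X,\mathcal TY}\circ(\iota\otimes\mathrm{id}_{\mathcal TY})$. A morphism of central cones $(Z',\iota')\to(Z,\iota)$ at $X$ is $\varphi:Z'\to Z$ with $\iota\circ\varphi=\iota'$; a terminal central cone at $X$ is a terminal object of the category of central cones at $X$. -}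

module Defs where

open import Level using (Level; _⊔_; suc)
open import Relation.Binary.Structures using (IsEquivalence)

record Category (o ℓ e : Level) : Set (suc (o ⊔ ℓ ⊔ e)) where
  infix  4 _≈_ _⇒_
  infixr 9 _∘_
  field
    Obj : Set o
    _⇒_ : Obj → Obj → Set ℓ
    _≈_ : ∀ {A B} → (A ⇒ B) → (A ⇒ B) → Set e
    id  : ∀ {A} → A ⇒ A
    _∘_ : ∀ {A B C} → B ⇒ C → A ⇒ B → A ⇒ C
    equiv     : ∀ {A B} → IsEquivalence (_≈_ {A} {B})
    assoc     : ∀ {A B C D} {f : A ⇒ B} {g : B ⇒ C} {h : C ⇒ D} →
                (h ∘ g) ∘ f ≈ h ∘ (g ∘ f)
    identityˡ : ∀ {A B} {f : A ⇒ B} → id ∘ f ≈ f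
    identityʳ : ∀ {A B} {f : A ⇒ B} → f ∘ id ≈ f
    ∘-resp-≈  : ∀ {A B C} {f h : B ⇒ C} {g i : A ⇒ B} →
                f ≈ h → g ≈ i → f ∘ g ≈ h ∘ i

  Mono : ∀ {A B} → A ⇒ B → Set (o ⊔ ℓ ⊔ e)
  Mono {A} f = ∀ {W} (g₁ g₂ : W ⇒ A) → f ∘ g₁ ≈ f ∘ g₂ → g₁ ≈ g₂

record Endofunctor {o ℓ e} (C : Category o ℓ e) : Set (o ⊔ ℓ ⊔ e) where
  open Category C
  field
    F₀ : Obj → Obj
    F₁ : ∀ {A B} → A ⇒ B → F₀ A ⇒ F₀ B
    identity     : ∀ {A} → F₁ (id {A}) ≈ id
    homomorphism : ∀ {A B C} {f : A ⇒ B} {g : B ⇒ C} →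
                   F₁ (g ∘ f) ≈ F₁ g ∘ F₁ f
    F-resp-≈     : ∀ {A B} {f g : A ⇒ B} → f ≈ g → F₁ f ≈ F₁ g

record SymmetricMonoidalCategory (o ℓ e : Level) : Set (suc (o ⊔ ℓ ⊔ e)) where
  field
    C : Category o ℓ e
  open Category C
  infixr 10 _⊗₀_ _⊗₁_
  field
    _⊗₀_ : Obj → Obj → Obj
    _⊗₁_ : ∀ {A B X Y} → A ⇒ B → X ⇒ Y → A ⊗₀ X ⇒ B ⊗₀ Y
    ⊗-identity     : ∀ {A X} → id {A} ⊗₁ id {X} ≈ id
    ⊗-homomorphism : ∀ {A B C' X Y Z} {f : A ⇒ B} {g : B ⇒ C'}
                       {h : X ⇒ Y} {k : Y ⇒ Z} →
                     (g ∘ f) ⊗₁ (k ∘ h) ≈ (g ⊗₁ k) ∘ (f ⊗₁ h)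
    ⊗-resp-≈       : ∀ {A B X Y} {f f' : A ⇒ B} {g g' : X ⇒ Y} →
                     f ≈ f' → g ≈ g' → f ⊗₁ g ≈ f' ⊗₁ g'
    I : Obj
    α⇒ : ∀ {X Y Z} → (X ⊗₀ Y) ⊗₀ Z ⇒ X ⊗₀ (Y ⊗₀ Z)
    α⇐ : ∀ {X Y Z} → X ⊗₀ (Y ⊗₀ Z) ⇒ (X ⊗₀ Y) ⊗₀ Z
    α-isoˡ : ∀ {X Y Z} → α⇐ ∘ α⇒ {X} {Y} {Z} ≈ id
    α-isoʳ : ∀ {X Y Z} → α⇒ ∘ α⇐ {X} {Y} {Z} ≈ id
    α-natural : ∀ {X X' Y Y' Z Z'} {f : X ⇒ X'} {g : Y ⇒ Y'} {h : Z ⇒ Z'} →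
                α⇒ ∘ ((f ⊗₁ g) ⊗₁ h) ≈ (f ⊗₁ (g ⊗₁ h)) ∘ α⇒
    λ⇒ : ∀ {X} → I ⊗₀ X ⇒ X
    λ⇐ : ∀ {X} → X ⇒ I ⊗₀ X
    λ-isoˡ : ∀ {X} → λ⇐ ∘ λ⇒ {X} ≈ id
    λ-isoʳ : ∀ {X} → λ⇒ ∘ λ⇐ {X} ≈ id
    λ-natural : ∀ {X Y} {f : X ⇒ Y} → λ⇒ ∘ (id ⊗₁ f) ≈ f ∘ λ⇒
    ρ⇒ : ∀ {X} → X ⊗₀ I ⇒ X
    ρ⇐ : ∀ {X} → X ⇒ X ⊗₀ I
    ρ-isoˡ : ∀ {X} → ρ⇐ ∘ ρ⇒ {X} ≈ id
    ρ-isoʳ : ∀ {X} → ρ⇒ ∘ ρ⇐ {X} ≈ id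
    ρ-natural : ∀ {X Y} {f : X ⇒ Y} → ρ⇒ ∘ (f ⊗₁ id) ≈ f ∘ ρ⇒
    triangle : ∀ {X Y} → (id {X} ⊗₁ λ⇒ {Y}) ∘ α⇒ ≈ ρ⇒ ⊗₁ id
    pentagon : ∀ {W X Y Z} →
               (id {W} ⊗₁ α⇒ {X} {Y} {Z}) ∘ (α⇒ ∘ (α⇒ ⊗₁ id)) ≈ α⇒ ∘ α⇒
    γ : ∀ {X Y} → X ⊗₀ Y ⇒ Y ⊗₀ X
    γ-natural : ∀ {X X' Y Y'} {f : X ⇒ X'} {g : Y ⇒ Y'} →
                γ ∘ (f ⊗₁ g) ≈ (g ⊗₁ f) ∘ γ
    γ-involutive : ∀ {X Y} → γ {Y} {X} ∘ γ {X} {Y} ≈ id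
    hexagon : ∀ {X Y Z} →
              α⇒ {Y} {Z} {X} ∘ (γ {X} {Y ⊗₀ Z} ∘ α⇒)
                ≈ (id ⊗₁ γ {X} {Z}) ∘ (α⇒ ∘ (γ {X} {Y} ⊗₁ id))

record StrongMonad {o ℓ e} (M : SymmetricMonoidalCategory o ℓ e)
       : Set (o ⊔ ℓ ⊔ e) where
  open SymmetricMonoidalCategory M
  open Category C
  field
    T : Endofunctor C
  open Endofunctor T
  field
    η : ∀ {X} → X ⇒ F₀ X
    μ : ∀ {X} → F₀ (F₀ X) ⇒ F₀ X
    η-natural : ∀ {X Y} {f : X ⇒ Y} → η ∘ f ≈ F₁ f ∘ η
    μ-natural : ∀ {X Y} {f : X ⇒ Y} → μ ∘ F₁ (F₁ f) ≈ F₁ f ∘ μ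
    μ-assoc     : ∀ {X} → μ {X} ∘ F₁ μ ≈ μ ∘ μ
    μ-identityˡ : ∀ {X} → μ {X} ∘ F₁ η ≈ id
    μ-identityʳ : ∀ {X} → μ {X} ∘ η ≈ id
    τ : ∀ {X Y} → X ⊗₀ F₀ Y ⇒ F₀ (X ⊗₀ Y)
    τ-natural : ∀ {X X' Y Y'} {f : X ⇒ X'} {g : Y ⇒ Y'} →
                τ ∘ (f ⊗₁ F₁ g) ≈ F₁ (f ⊗₁ g) ∘ τ
    τ-unit    : ∀ {X} → F₁ λ⇒ ∘ τ {I} {X} ≈ λ⇒
    τ-assoc   : ∀ {X Y Z} →
                F₁ (α⇒ {X} {Y} {Z}) ∘ τ ≈ τ ∘ ((id ⊗₁ τ) ∘ α⇒)
    τ-η       : ∀ {X Y} → τ {X} {Y} ∘ (id ⊗₁ η) ≈ η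
    τ-μ       : ∀ {X Y} → τ {X} {Y} ∘ (id ⊗₁ μ) ≈ μ ∘ (F₁ τ ∘ τ)

  τ' : ∀ {X Y} → F₀ X ⊗₀ Y ⇒ F₀ (X ⊗₀ Y)
  τ' {X} {Y} = F₁ (γ {Y} {X}) ∘ (τ {Y} {X} ∘ γ {F₀ X} {Y})

  record CentralCone (X : Obj) : Set (o ⊔ ℓ ⊔ e) where
    field
      Z : Obj
      ι : Z ⇒ F₀ X
      central : ∀ Y →
        μ {X ⊗₀ Y} ∘ (F₁ (τ' {X} {Y}) ∘ (τ {F₀ X} {Y} ∘ (ι ⊗₁ id {F₀ Y})))
          ≈ μ {X ⊗₀ Y} ∘ (F₁ (τ {X} {Y}) ∘ (τ' {X} {F₀ Y} ∘ (ι ⊗₁ id {F₀ Y})))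

  record ConeMorphism {X : Obj} (K' K : CentralCone X) : Set (ℓ ⊔ e) where
    open CentralCone
    field
      φ : Z K' ⇒ Z K
      commutes : ι K ∘ φ ≈ ι K'

  record IsTerminalCentralCone {X : Obj} (K : CentralCone X) : Set (o ⊔ ℓ ⊔ e) where
    field
      ! : (K' : CentralCone X) → ConeMorphism K' K
      !-unique : {K' : CentralCone X} (m n : ConeMorphism K' K) →
                 ConeMorphism.φ m ≈ ConeMorphism.φ n

module Submission where

open import Defs
open import Relation.Binary.Bundles using (Setoid)
import Relation.Binary.Reasoning.Setoid as SetoidReasoning

module CategoryProperties {o ℓ e} (C : Category o ℓ e) where
  open Category C

  hom-setoid : Obj → Obj → Setoid ℓ e
  hom-setoid A B = record { isEquivalence = equiv {A} {B} }

  module HomReasoning {A B : Obj} = SetoidReasoning (hom-setoid A B)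
  module Equiv {A B : Obj} = Setoid (hom-setoid A B)
  open Equiv using (refl; sym; trans)

  ∘-assoc³ : ∀ {A B C′ D E F} {a : E ⇒ F} {b : D ⇒ E} {c : C′ ⇒ D} {d : B ⇒ C′} {x : A ⇒ B} →
             a ∘ (b ∘ (c ∘ (d ∘ x))) ≈ (a ∘ (b ∘ (c ∘ d))) ∘ x
  ∘-assoc³ = sym (trans assoc (∘-resp-≈ refl (trans assoc (∘-resp-≈ refl assoc))))

module SymmetricMonoidalProperties {o ℓ e} (M : SymmetricMonoidalCategory o ℓ e) where
  open SymmetricMonoidalCategory M
  open Category C
  open CategoryProperties C
  open Equiv using (refl; sym; trans)

  ⊗-homomorphismˡ : ∀ {A B C′ Y} {f : A ⇒ B} {g : B ⇒ C′} →
                    (g ∘ f) ⊗₁ id {Y} ≈ (g ⊗₁ id) ∘ (f ⊗₁ id)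
  ⊗-homomorphismˡ = trans (⊗-resp-≈ refl (sym identityˡ)) ⊗-homomorphism

module _ {o ℓ e} {M : SymmetricMonoidalCategory o ℓ e} (S : StrongMonad M) where
  open SymmetricMonoidalCategory M
  open Category C
  open CategoryProperties C
  open SymmetricMonoidalProperties M
  open StrongMonad S
  open Endofunctor T

  -- Centrality is a condition on (ι ⊗ id) precomposed with fixed arrows, so it survives
  -- precomposing ι with anything.
  precompose : ∀ {X W} (K : CentralCone X) → W ⇒ CentralCone.Z K → CentralCone X
  precompose {W = W} K g = record
    { Z = W
    ; ι = ι ∘ g
    ; central = λ Y → begin
        μ ∘ (F₁ τ' ∘ (τ ∘ ((ι ∘ g) ⊗₁ id)))       ≈⟨ ∘-resp-≈ refl (∘-resp-≈ refl (∘-resp-≈ refl ⊗-homomorphismˡ)) ⟩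
        μ ∘ (F₁ τ' ∘ (τ ∘ ((ι ⊗₁ id) ∘ (g ⊗₁ id)))) ≈⟨ ∘-assoc³ ⟩
        (μ ∘ (F₁ τ' ∘ (τ ∘ (ι ⊗₁ id)))) ∘ (g ⊗₁ id) ≈⟨ ∘-resp-≈ (central Y) refl ⟩
        (μ ∘ (F₁ τ ∘ (τ' ∘ (ι ⊗₁ id)))) ∘ (g ⊗₁ id) ≈˘⟨ ∘-assoc³ ⟩
        μ ∘ (F₁ τ ∘ (τ' ∘ ((ι ⊗₁ id) ∘ (g ⊗₁ id)))) ≈˘⟨ ∘-resp-≈ refl (∘-resp-≈ refl (∘-resp-≈ refl ⊗-homomorphismˡ)) ⟩
        μ ∘ (F₁ τ ∘ (τ' ∘ ((ι ∘ g) ⊗₁ id)))       ∎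
    }
    where
    open CentralCone K
    open Equiv using (refl)
    open HomReasoning

  precompose-morphism : ∀ {X W} (K : CentralCone X) (g : W ⇒ CentralCone.Z K) →
                        ConeMorphism (precompose K g) K
  precompose-morphism K g = record { φ = g ; commutes = Equiv.refl }

mainTheorem5 : ∀ {o ℓ e} (M : SymmetricMonoidalCategory o ℓ e) (S : StrongMonad M)
    (X : Category.Obj (SymmetricMonoidalCategory.C M))
    (K : StrongMonad.CentralCone S X) →
    StrongMonad.IsTerminalCentralCone S K →
    Category.Mono (SymmetricMonoidalCategory.C M) (StrongMonad.CentralCone.ι K)
mainTheorem5 M S X K terminal g₁ g₂ ιg₁≈ιg₂ =
  IsTerminalCentralCone.!-unique terminal (precompose-morphism S K g₁) g₂-as-morphism
  where
  open StrongMonad S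
  open CategoryProperties (SymmetricMonoidalCategory.C M)

  -- Since ι ∘ g₁ ≈ ι ∘ g₂, both g₁ and g₂ are cone morphisms into K; terminality identifies them.
  g₂-as-morphism : ConeMorphism (precompose S K g₁) K
  g₂-as-morphism = record { φ = g₂ ; commutes = Equiv.sym ιg₁≈ιg₂ }
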